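{- Let $n\ge 2$ and let $H_n$ be the graph defined below. Then $H_n$, rooted at a vertex of degree $\lfloor \frac{n}{2}\rfloor$, is a double-rooted global amoeba and a double-rooted local amoeba.
   Context: The graph $H_n$: let $q=\lfloor n/2\rfloor$, $V(H_n)=A\cup B$ with $A=\{v_1,\dots,v_q\}$ and $B=\{v_{q+1},\dots,v_{q+\lceil n/2\rceil}\}$; $B$ is a clique, $A$ is an independent set, and for $1\le i\le q$, $1\le j\le\lceil n/2\rceil$, $v_iv_{q+j}\in E(H_n)$ iff $j\le i$. All graphs are finite and simple; $[n]=\{1,\dots,n\}$ and $S_n$ is the symmetric group on $[n]$. For a graph $G$ on vertex set $V=\{v_1,\dots,v_n\}$ (viewed as a spanning subgraph of the complete graph $K_n$ on $V$) and $\sigma\in S_n$, let $G_\sigma$ be the graph on $V$ with edge set $\{v_{\sigma^{ -1}(i)}v_{\sigma^{ -1}(j)} : v_iv_j\in E(G)\}$. Let $A_G=\{\sigma\in S_n : G_\sigma=G\}$. An edge-replacement $v_rv_s\to v_kv_l$ with $v_rv_s\in E(G)$, $v_kv_l\notin E(G)$ is feasible if $G-v_rv_s+v_kv_l\cong G$; for it let $S_G(rs\to kl)=\{\sigma\in S_n : G_\sigma=G-v_rv_s+v_kv_l\}$. Let $\mathcal{E}_G$ be the union of $A_G$ with all sets $S_G(rs\to kl)$ over feasible edge-replacements, and let $S_G$ be the subgroup of $S_n$ generated by $\mathcal{E}_G$. $G$ is a local amoeba if $S_G=S_n$. For $k\in[n]$, ${\rm Stab}_{S_G}(k)=\{\sigma\in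 S_G:\sigma(k)=k\}$. A graph $G$ rooted at $v_k$ is stem-transitive if there is a set $S\subseteq {\rm Stab}_{S_G}(k)$ such that the group generated by $S$ acts transitively on $[n]\setminus\{k\}$. A vertex $v_j$, $j\ne k$, is root-similar if there is $\varphi\in A_G$ with $\varphi(k)=j$. A rooted graph $G$ with minimum degree $\delta(G)=1$ that is stem-transitive and has a root-similar vertex is called a double-rooted global amoeba; if moreover $G$ is a local amoeba, it is called a double-rooted local amoeba. -}

module Defs where

open import Data.Nat using (ℕ; _≤_; _∸_; _<ᵇ_; _≤ᵇ_; ⌊_/2⌋)
open import Data.Bool using (Bool; true; false; if_then_else_; _∧_; _∨_; not)
open import Data.Fin using (Fin; toℕ; _≟_)
open import Data.Fin.Permutation using (Permutation′; _⟨$⟩ʳ_; id; flip; _∘ₚ_)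
open import Data.List using (List; map; allFin)
open import Data.Nat.ListAction using (sum)
open import Data.Product using (Σ; _×_; _,_)
open import Data.Sum using (_⊎_)
open import Relation.Nullary using (¬_; ⌊_⌋)
open import Relation.Binary.PropositionalEquality using (_≡_; _≢_)

Graph : ℕ → Set
Graph n = Fin n → Fin n → Bool

_≐_ : ∀ {n} → Graph n → Graph n → Set
G ≐ G' = ∀ a b → G a b ≡ G' a b

Perm : ℕ → Set
Perm = Permutation′

-- G_σ : v_a v_b is an edge of G_σ iff v_{σ(a)} v_{σ(b)} is an edge of G
-- (equivalently E(G_σ) = { v_{σ⁻¹ i} v_{σ⁻¹ j} : v_i v_j ∈ E(G) }).
_⟪_⟫ : ∀ {n} → Graph n → Perm n → Graph n
(G ⟪ σ ⟫) a b = G (σ ⟨$⟩ʳ a) (σ ⟨$⟩ʳ b)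

_≅_ : ∀ {n} → Graph n → Graph n → Set
G ≅ G' = Σ (Perm _) λ σ → (G' ⟪ σ ⟫) ≐ G

samePair : ∀ {n} → Fin n → Fin n → Fin n → Fin n → Bool
samePair a b r s = (⌊ a ≟ r ⌋ ∧ ⌊ b ≟ s ⌋) ∨ (⌊ a ≟ s ⌋ ∧ ⌊ b ≟ r ⌋)

replace : ∀ {n} → Graph n → (r s k l : Fin n) → Graph n
replace G r s k l a b = (G a b ∧ not (samePair a b r s)) ∨ samePair a b k l

Aut : ∀ {n} → Graph n → Perm n → Set
Aut G σ = (G ⟪ σ ⟫) ≐ G

Feasible : ∀ {n} → Graph n → (r s k l : Fin n) → Set
Feasible G r s k l =
  (G r s ≡ true) × (k ≢ l) × (G k l ≡ false) × (replace G r s k l ≅ G)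

SRep : ∀ {n} → Graph n → (r s k l : Fin n) → Perm n → Set
SRep G r s k l σ = (G ⟪ σ ⟫) ≐ replace G r s k l

𝓔 : ∀ {n} → Graph n → Perm n → Set
𝓔 {n} G σ = Aut G σ ⊎
  Σ (Fin n) λ r → Σ (Fin n) λ s → Σ (Fin n) λ k → Σ (Fin n) λ l →
    Feasible G r s k l × SRep G r s k l σ

-- The subgroup of S_n generated by a set X of permutations
-- (permutations are identified up to pointwise equality).
data ⟨_⟩ {n : ℕ} (X : Perm n → Set) : Perm n → Set where
  gen  : ∀ {σ} → X σ → ⟨ X ⟩ σ
  unit : ⟨ X ⟩ id
  comp : ∀ {σ τ} → ⟨ X ⟩ σ → ⟨ X ⟩ τ → ⟨ X ⟩ (σ ∘ₚ τ)
  inv  : ∀ {σ} → ⟨ X ⟩ σ → ⟨ X ⟩ (flip σ)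
  ext  : ∀ {σ τ} → (∀ i → σ ⟨$⟩ʳ i ≡ τ ⟨$⟩ʳ i) → ⟨ X ⟩ σ → ⟨ X ⟩ τ

SG : ∀ {n} → Graph n → Perm n → Set
SG G = ⟨ 𝓔 G ⟩

LocalAmoeba : ∀ {n} → Graph n → Set
LocalAmoeba {n} G = (σ : Perm n) → SG G σ

Stab : ∀ {n} → Graph n → Fin n → Perm n → Set
Stab G k σ = SG G σ × (σ ⟨$⟩ʳ k ≡ k)

StemTransitive : ∀ {n} → Graph n → Fin n → Set₁
StemTransitive {n} G k =
  Σ (Perm n → Set) λ S →
    (∀ σ → S σ → Stab G k σ) ×
    (∀ i j → i ≢ k → j ≢ k → Σ (Perm n) λ τ → ⟨ S ⟩ τ × (τ ⟨$⟩ʳ i ≡ j))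

RootSimilar : ∀ {n} → Graph n → (k j : Fin n) → Set
RootSimilar {n} G k j = (j ≢ k) × Σ (Perm n) λ φ → Aut G φ × (φ ⟨$⟩ʳ k ≡ j)

deg : ∀ {n} → Graph n → Fin n → ℕ
deg {n} G v = sum (map (λ j → if G v j then 1 else 0) (allFin n))

MinDegOne : ∀ {n} → Graph n → Set
MinDegOne {n} G = (∀ v → 1 ≤ deg G v) × Σ (Fin n) λ v → deg G v ≡ 1

DoubleRootedGlobalAmoeba : ∀ {n} → Graph n → Fin n → Set₁
DoubleRootedGlobalAmoeba {n} G k =
  MinDegOne G × StemTransitive G k × Σ (Fin n) λ j → RootSimilar G k j

DoubleRootedLocalAmoeba : ∀ {n} → Graph n → Fin n → Set₁
DoubleRootedLocalAmoeba G k = DoubleRootedGlobalAmoeba G k × LocalAmoeba G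

-- H_n, 0-based: v_{i+1} ↦ index i.  A = indices < q, B = indices ≥ q,
-- q = ⌊n/2⌋.  B clique, A independent, and for a ∈ A, b ∈ B:
-- ab edge iff (b - q + 1) ≤ (a + 1), i.e. b ∸ q ≤ a.
H : (n : ℕ) → Graph n
H n a b =
  let q = ⌊ n /2⌋
      i = toℕ a
      j = toℕ b
  in if i <ᵇ q
     then (if j <ᵇ q then false else (j ∸ q) ≤ᵇ i)
     else (if j <ᵇ q then (i ∸ q) ≤ᵇ j else not ⌊ a ≟ b ⌋)

-- Both sides of H_n are ladders: along A = v_1, …, v_q and along B read downwards from v_n,
-- each vertex x and the next one y have the same neighbours apart from each other and one
-- vertex c, adjacent to y but not to x. The transposition (x y) then maps H_n onto
-- H_n − yc + xc, so it lies in S_{H_n}, and deg y = deg x + 1. The tops v_q and v_n of the two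
-- ladders are twins, so (v_q v_n) is an automorphism. Hence deg v_i = i on A and
-- deg v_{q+j} = n − j on B: v_1 has degree 1, and the vertices of degree ⌊n/2⌋ are exactly v_q
-- and v_n, swapped by an automorphism. The transpositions along the ladders together with
-- (v_q v_n) connect all vertices, so they generate S_n; stem-transitivity then holds because
-- (i j) fixes the root.

module Submission where

open import Defs
open import Data.Bool using (Bool; true; false; if_then_else_; not; _∧_; _∨_)
open import Data.Bool.Properties using (∨-zeroʳ; ∨-identityʳ; ∧-identityʳ; ∧-zeroʳ; ∨-comm; ∧-comm)
open import Data.Fin using (Fin; zero; suc; toℕ; _≟_; punchIn; fromℕ<)
open import Data.Fin.Properties using (punchInᵢ≢i; toℕ-injective; toℕ-fromℕ<; toℕ<n)
open import Data.Fin.Permutation using (transpose; _⟨$⟩ʳ_)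
open import Data.Fin.Permutation.Transposition.List using (TranspositionList; eval; decompose; eval-decompose)
open import Data.List using ([]; _∷_; tabulate)
open import Data.List.Properties using (map-tabulate)
import Data.Nat.ListAction as List
open import Data.Nat using (ℕ; zero; suc; _+_; _∸_; _<_; _≤_; _<ᵇ_; _≤ᵇ_; _≡ᵇ_; _<?_; _≤?_; z≤n; s≤s; z<s; ⌊_/2⌋; ⌈_/2⌉)
open import Data.Nat.Properties
  using ( +-0-commutativeMonoid; +-comm; +-suc; +-identityʳ; +-cancelˡ-≡; +-cancelʳ-≡; +-cancelˡ-≤
        ; +-monoʳ-≤; +-monoʳ-<; suc-injective; ≤-refl; ≤-trans; ≤-pred; <-trans; <-≤-trans; <⇒≤
        ; <⇒≢; >⇒≢; ≤∧≢⇒<; ≮⇒≥; n≮n; n<1+n; n≤1+n; m≤n⇒m≤1+n; m≤m+n; m≤n+m; m<m+n; m+n≮m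
        ; n≤0⇒n≡0; m+[n∸m]≡n; m+n∸m≡n; m≤n+o⇒m∸n≤o; ⌊n/2⌋+⌈n/2⌉≡n; ⌊n/2⌋≤⌈n/2⌉; ⌊n/2⌋-mono )
  renaming (_≟_ to _≟ℕ_)
open import Algebra.Properties.CommutativeMonoid.Sum +-0-commutativeMonoid
  using (sum; sum-permute; sum-remove; sum-cong-≗; sum-replicate-zero)
open import Data.Product using (Σ-syntax; _×_; _,_)
open import Data.Sum using (_⊎_; inj₁; inj₂)
open import Data.Vec.Functional using (removeAt)
open import Function using (_∘_)
open import Relation.Nullary using (Dec; yes; no; ⌊_⌋)
open import Relation.Nullary.Decidable using (dec-true; dec-false; isYes≗does; ⌊⌋-map′)
open import Relation.Binary.PropositionalEquality

private variable n : ℕ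

-- Transpositions and the subgroups they generate

transpose-matchˡ : (i j : Fin n) → transpose i j ⟨$⟩ʳ i ≡ j
transpose-matchˡ i j rewrite dec-true (i ≟ i) refl = refl

transpose-matchʳ : (i j : Fin n) → transpose i j ⟨$⟩ʳ j ≡ i
transpose-matchʳ i j with j ≟ i
... | yes j≡i = j≡i
... | no _ rewrite dec-true (j ≟ j) refl = refl

module _ {i j : Fin n} where

  transpose-fix : ∀ {k} → k ≢ i → k ≢ j → transpose i j ⟨$⟩ʳ k ≡ k
  transpose-fix {k} k≢i k≢j rewrite dec-false (k ≟ i) k≢i | dec-false (k ≟ j) k≢j = refl

  transpose-≗ : ∀ {A : Set} {F F′ : Fin n → A} → F j ≡ F′ i → F i ≡ F′ j →
    (∀ k → k ≢ i → k ≢ j → F k ≡ F′ k) → ∀ k → F (transpose i j ⟨$⟩ʳ k) ≡ F′ k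
  transpose-≗ {F = F} {F′} Fj Fi Fk k = by-cases (k ≟ i) (k ≟ j)
    where
    by-cases : Dec (k ≡ i) → Dec (k ≡ j) → F (transpose i j ⟨$⟩ʳ k) ≡ F′ k
    by-cases (yes refl) _         = trans (cong F (transpose-matchˡ i j)) Fj
    by-cases (no _)     (yes refl) = trans (cong F (transpose-matchʳ i j)) Fi
    by-cases (no k≢i)   (no k≢j)   = trans (cong F (transpose-fix k≢i k≢j)) (Fk k k≢i k≢j)

transpose-self : (i k : Fin n) → transpose i i ⟨$⟩ʳ k ≡ k
transpose-self i = transpose-≗ {F = λ k → k} refl refl (λ _ _ _ → refl)

transpose-comm : (i j k : Fin n) → transpose i j ⟨$⟩ʳ k ≡ transpose j i ⟨$⟩ʳ k
transpose-comm i j = transpose-≗ {F = λ k → k} (sym (transpose-matchʳ j i)) (sym (transpose-matchˡ j i))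
  (λ k k≢i k≢j → sym (transpose-fix k≢j k≢i))

transpose-conj : {a b c : Fin n} → a ≢ b → b ≢ c → a ≢ c → ∀ k →
  transpose a b ⟨$⟩ʳ (transpose b c ⟨$⟩ʳ (transpose a b ⟨$⟩ʳ k)) ≡ transpose a c ⟨$⟩ʳ k
transpose-conj {a = a} {b} {c} a≢b b≢c a≢c =
  transpose-≗ (trans (cong (transpose a b ⟨$⟩ʳ_) (transpose-matchˡ b c)) c-fixed)
              (trans (cong (transpose a b ⟨$⟩ʳ_) (transpose-fix a≢b a≢c))
                     (trans (transpose-matchˡ a b) (sym (transpose-fix (a≢b ∘ sym) b≢c))))
              off
  where
  c-fixed : transpose a b ⟨$⟩ʳ c ≡ transpose a c ⟨$⟩ʳ a
  c-fixed = trans (transpose-fix (a≢c ∘ sym) (b≢c ∘ sym)) (sym (transpose-matchˡ a c))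
  off : ∀ k → k ≢ a → k ≢ b → transpose a b ⟨$⟩ʳ (transpose b c ⟨$⟩ʳ k) ≡ transpose a c ⟨$⟩ʳ k
  off k k≢a k≢b with k ≟ c
  ... | yes refl = trans (cong (transpose a b ⟨$⟩ʳ_) (transpose-matchʳ b c))
                         (trans (transpose-matchʳ a b) (sym (transpose-matchʳ a c)))
  ... | no k≢c = trans (cong (transpose a b ⟨$⟩ʳ_) (transpose-fix k≢b k≢c))
                       (trans (transpose-fix k≢a k≢b) (sym (transpose-fix k≢a k≢c)))

Swappable : (Perm n → Set) → Fin n → Fin n → Set
Swappable X i j = ⟨ X ⟩ (transpose i j)

module _ {X : Perm n → Set} where

  swappable-refl : ∀ {i} → Swappable X i i
  swappable-refl {i} = ext (λ k → sym (transpose-self i k)) unit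

  swappable-sym : ∀ {i j} → Swappable X i j → Swappable X j i
  swappable-sym {i} {j} = ext (transpose-comm i j)

  swappable-trans : ∀ {i j k} → Swappable X i j → Swappable X j k → Swappable X i k
  swappable-trans {i} {j} {k} s t with i ≟ j | j ≟ k | i ≟ k
  ... | yes refl | _        | _        = t
  ... | no _     | yes refl | _        = s
  ... | no _     | no _     | yes refl = swappable-refl
  ... | no i≢j   | no j≢k   | no i≢k   = ext (transpose-conj i≢j j≢k i≢k) (comp s (comp t s))

  all-swappable⇒all : (∀ i j → Swappable X i j) → ∀ σ → ⟨ X ⟩ σ
  all-swappable⇒all sw σ = ext (eval-decompose σ) (product (decompose σ))
    where
    product : (ts : TranspositionList n) → ⟨ X ⟩ (eval ts)
    product []            = unit
    product ((i , j) ∷ ts) = comp (sw i j) (product ts)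

-- Twins, edge replacements and degrees

Symmetric : {V : Set} → (V → V → Bool) → Set
Symmetric G = ∀ a b → G a b ≡ G b a

Irreflexive : {V : Set} → (V → V → Bool) → Set
Irreflexive G = ∀ a → G a a ≡ false

Twins : {V : Set} → (V → V → Bool) → V → V → Set
Twins G x y = ∀ d → d ≢ x → d ≢ y → G x d ≡ G y d

twins-sym : {V : Set} {G : V → V → Bool} {x y : V} → Twins G x y → Twins G y x
twins-sym tw d d≢y d≢x = sym (tw d d≢x d≢y)

record ShiftedTwins {V : Set} (G : V → V → Bool) (x y c : V) : Set where
  field
    x≢y   : x ≢ y
    c≢x   : c ≢ x
    c≢y   : c ≢ y
    x≁c   : G x c ≡ false
    y∼c   : G y c ≡ true
    twins : ∀ d → d ≢ x → d ≢ y → d ≢ c → G x d ≡ G y d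

⌊≟⌋-refl : (a : Fin n) → ⌊ a ≟ a ⌋ ≡ true
⌊≟⌋-refl a = trans (isYes≗does (a ≟ a)) (dec-true (a ≟ a) refl)

⌊≟⌋-≢ : {a b : Fin n} → a ≢ b → ⌊ a ≟ b ⌋ ≡ false
⌊≟⌋-≢ {a = a} {b} a≢b = trans (isYes≗does (a ≟ b)) (dec-false (a ≟ b) a≢b)

samePair-comm : (a b r s : Fin n) → samePair b a r s ≡ samePair a b r s
samePair-comm a b r s = trans (cong₂ _∨_ (∧-comm ⌊ b ≟ r ⌋ _) (∧-comm ⌊ b ≟ s ⌋ _))
                              (∨-comm (⌊ a ≟ s ⌋ ∧ ⌊ b ≟ r ⌋) _)

module _ {a b r s : Fin n} where

  samePair-≢₁ : a ≢ r → b ≢ r → samePair a b r s ≡ false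
  samePair-≢₁ a≢r b≢r rewrite ⌊≟⌋-≢ a≢r | ⌊≟⌋-≢ b≢r = ∧-zeroʳ _

  samePair-≢₂ : a ≢ s → b ≢ s → samePair a b r s ≡ false
  samePair-≢₂ a≢s b≢s rewrite ⌊≟⌋-≢ a≢s | ⌊≟⌋-≢ b≢s = trans (∨-identityʳ _) (∧-zeroʳ _)

  samePair-≢ˡ : a ≢ r → a ≢ s → samePair a b r s ≡ false
  samePair-≢ˡ a≢r a≢s rewrite ⌊≟⌋-≢ a≢r | ⌊≟⌋-≢ a≢s = refl

  samePair-≢ʳ : b ≢ r → b ≢ s → samePair a b r s ≡ false
  samePair-≢ʳ b≢r b≢s rewrite ⌊≟⌋-≢ b≢r | ⌊≟⌋-≢ b≢s =
    cong₂ _∨_ (∧-zeroʳ ⌊ a ≟ r ⌋) (∧-zeroʳ ⌊ a ≟ s ⌋)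

samePair-refl : (a b : Fin n) → samePair a b a b ≡ true
samePair-refl a b rewrite ⌊≟⌋-refl a | ⌊≟⌋-refl b = refl

module _ (G : Graph n) {r s k l : Fin n} where

  replace-sym : Symmetric G → Symmetric (replace G r s k l)
  replace-sym G-sym a b =
    cong₂ _∨_ (cong₂ _∧_ (G-sym a b) (cong not (sym (samePair-comm a b r s)))) (sym (samePair-comm a b k l))

  replace-kept : ∀ {a b} → samePair a b r s ≡ false → samePair a b k l ≡ false →
    replace G r s k l a b ≡ G a b
  replace-kept {a} {b} ≢rs ≢kl rewrite ≢rs | ≢kl = trans (∨-identityʳ _) (∧-identityʳ _)

  replace-added : ∀ {a b} → samePair a b k l ≡ true → replace G r s k l a b ≡ true
  replace-added ≡kl rewrite ≡kl = ∨-zeroʳ _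

  replace-removed : ∀ {a b} → samePair a b r s ≡ true → samePair a b k l ≡ false →
    replace G r s k l a b ≡ false
  replace-removed {a} {b} ≡rs ≢kl rewrite ≡rs | ≢kl = trans (∨-identityʳ _) (∧-zeroʳ _)

module _ {G G′ : Graph n} {x y : Fin n} (G-sym : Symmetric G) (G′-sym : Symmetric G′) where

  ⟪transpose⟫≐ : (∀ a b → a ≢ x → a ≢ y → b ≢ x → b ≢ y → G a b ≡ G′ a b) →
    (∀ b → G y (transpose x y ⟨$⟩ʳ b) ≡ G′ x b) →
    (∀ b → G x (transpose x y ⟨$⟩ʳ b) ≡ G′ y b) →
    (G ⟪ transpose x y ⟫) ≐ G′
  ⟪transpose⟫≐ off row-x row-y a b = by-cases (a ≟ x) (a ≟ y)
    where
    τ : Fin n → Fin n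
    τ = transpose x y ⟨$⟩ʳ_
    at : ∀ {z} → τ a ≡ z → G (τ a) (τ b) ≡ G z (τ b)
    at = cong (λ w → G w (τ b))
    by-cases : Dec (a ≡ x) → Dec (a ≡ y) → G (τ a) (τ b) ≡ G′ a b
    by-cases (yes refl) _ = trans (at (transpose-matchˡ x y)) (row-x b)
    by-cases (no _) (yes refl) = trans (at (transpose-matchʳ x y)) (row-y b)
    by-cases (no a≢x) (no a≢y) = trans (at (transpose-fix a≢x a≢y)) (transpose-≗
      (trans (G-sym a y) (trans (cong (G y) (sym (transpose-fix a≢x a≢y))) (trans (row-x a) (G′-sym x a))))
      (trans (G-sym a x) (trans (cong (G x) (sym (transpose-fix a≢x a≢y))) (trans (row-y a) (G′-sym y a))))
      (λ d d≢x d≢y → off a d a≢x a≢y d≢x d≢y) b)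

module _ {G : Graph n} (G-sym : Symmetric G) (G-irr : Irreflexive G) where

  twins⇒Aut : ∀ {x y} → Twins G x y → Aut G (transpose x y)
  twins⇒Aut {x} {y} tw = ⟪transpose⟫≐ G-sym G-sym (λ _ _ _ _ _ _ → refl)
    (transpose-≗ (trans (G-irr y) (sym (G-irr x))) (G-sym y x) (λ d d≢x d≢y → sym (tw d d≢x d≢y)))
    (transpose-≗ (G-sym x y) (trans (G-irr x) (sym (G-irr y))) tw)

  shiftedTwins⇒SRep : ∀ {x y c} → ShiftedTwins G x y c → SRep G y c x c (transpose x y)
  shiftedTwins⇒SRep {x} {y} {c} st = ⟪transpose⟫≐ G-sym (replace-sym G G-sym)
    (λ a b a≢x a≢y b≢x b≢y → sym (replace-kept G (samePair-≢₁ a≢y b≢y) (samePair-≢₁ a≢x b≢x)))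
    (transpose-≗
      (trans (G-irr y) (sym (trans (keep-x (samePair-≢₁ x≢y x≢y) (samePair-≢₂ x≢c x≢c)) (G-irr x))))
      (trans (G-sym y x) (sym (keep-x (samePair-≢ˡ x≢y x≢c) (samePair-≢ʳ {a = x} y≢x y≢c))))
      (λ d d≢x d≢y → row-x-off d d≢x d≢y (d ≟ c)))
    (transpose-≗
      (trans (G-sym x y) (sym (keep-y (samePair-≢ʳ {a = y} x≢y x≢c) (samePair-≢ˡ y≢x y≢c))))
      (trans (G-irr x) (sym (trans (keep-y (samePair-≢₂ y≢c y≢c) (samePair-≢₁ y≢x y≢x)) (G-irr y))))
      (λ d d≢x d≢y → row-y-off d d≢x d≢y (d ≟ c)))
    where
    open ShiftedTwins st
    x≢c : x ≢ c
    x≢c = c≢x ∘ sym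
    y≢c : y ≢ c
    y≢c = c≢y ∘ sym
    y≢x : y ≢ x
    y≢x = x≢y ∘ sym
    keep-x : ∀ {b} → samePair x b y c ≡ false → samePair x b x c ≡ false →
      replace G y c x c x b ≡ G x b
    keep-x = replace-kept G
    keep-y : ∀ {b} → samePair y b y c ≡ false → samePair y b x c ≡ false →
      replace G y c x c y b ≡ G y b
    keep-y = replace-kept G
    row-x-off : ∀ d → d ≢ x → d ≢ y → Dec (d ≡ c) → G y d ≡ replace G y c x c x d
    row-x-off d d≢x d≢y (yes refl) = trans y∼c (sym (replace-added G (samePair-refl x d)))
    row-x-off d d≢x d≢y (no d≢c) =
      sym (trans (keep-x (samePair-≢ˡ x≢y x≢c) (samePair-≢ʳ {a = x} d≢x d≢c)) (twins d d≢x d≢y d≢c))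
    row-y-off : ∀ d → d ≢ x → d ≢ y → Dec (d ≡ c) → G x d ≡ replace G y c x c y d
    row-y-off d d≢x d≢y (yes refl) =
      trans x≁c (sym (replace-removed G (samePair-refl y d) (samePair-≢ˡ y≢x y≢c)))
    row-y-off d d≢x d≢y (no d≢c) =
      trans (twins d d≢x d≢y d≢c) (sym (keep-y (samePair-≢ʳ {a = y} d≢y d≢c) (samePair-≢ˡ y≢x y≢c)))

  shiftedTwins⇒𝓔 : ∀ {x y c} → ShiftedTwins G x y c → 𝓔 G (transpose x y)
  shiftedTwins⇒𝓔 {x} {y} {c} st =
    inj₂ (y , c , x , c , (y∼c , c≢x ∘ sym , x≁c , (transpose x y , srep)) , srep)
    where
    open ShiftedTwins st
    srep : SRep G y c x c (transpose x y)
    srep = shiftedTwins⇒SRep st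

indicator : Bool → ℕ
indicator b = if b then 1 else 0

count : (Fin n → Bool) → ℕ
count f = sum (indicator ∘ f)

sum-tabulate : (g : Fin n → ℕ) → List.sum (tabulate g) ≡ sum g
sum-tabulate {zero} g = refl
sum-tabulate {suc n} g = cong (g zero +_) (sum-tabulate (g ∘ suc))

count-flip : ∀ {f g : Fin n → Bool} {c} → f c ≡ false → g c ≡ true →
  (∀ d → d ≢ c → f d ≡ g d) → count g ≡ suc (count f)
count-flip {suc n} {f} {g} {c} fc gc f≡g = begin
  count g                         ≡⟨ sum-remove {i = c} (indicator ∘ g) ⟩
  indicator (g c) + rest g        ≡⟨ cong₂ _+_ (cong indicator gc) rest-g≡rest-f ⟩
  suc (indicator false + rest f)  ≡⟨ cong (λ b → suc (indicator b + rest f)) fc ⟨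
  suc (indicator (f c) + rest f)  ≡⟨ cong suc (sum-remove {i = c} (indicator ∘ f)) ⟨
  suc (count f)                   ∎
  where
  open ≡-Reasoning
  rest : (Fin (suc n) → Bool) → ℕ
  rest h = sum (removeAt (indicator ∘ h) c)
  rest-g≡rest-f : rest g ≡ rest f
  rest-g≡rest-f = sum-cong-≗ (λ j → cong indicator (sym (f≡g (punchIn c j) (punchInᵢ≢i c j))))

deg≡count : (G : Graph n) (v : Fin n) → deg G v ≡ count (G v)
deg≡count G v =
  trans (cong List.sum (map-tabulate (λ i → i) (indicator ∘ G v))) (sum-tabulate (indicator ∘ G v))

deg-≐ : {G G′ : Graph n} → G ≐ G′ → ∀ v → deg G v ≡ deg G′ v
deg-≐ {G = G} {G′} G≐G′ v = begin
  deg G v      ≡⟨ deg≡count G v ⟩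
  count (G v)  ≡⟨ sum-cong-≗ (cong indicator ∘ G≐G′ v) ⟩
  count (G′ v) ≡⟨ deg≡count G′ v ⟨
  deg G′ v     ∎
  where open ≡-Reasoning

deg-⟪⟫ : (G : Graph n) (σ : Perm n) (v : Fin n) → deg (G ⟪ σ ⟫) v ≡ deg G (σ ⟨$⟩ʳ v)
deg-⟪⟫ G σ v = begin
  deg (G ⟪ σ ⟫) v            ≡⟨ deg≡count (G ⟪ σ ⟫) v ⟩
  count (G (σ ⟨$⟩ʳ v) ∘ (σ ⟨$⟩ʳ_)) ≡⟨ sum-permute _ σ ⟨
  count (G (σ ⟨$⟩ʳ v))        ≡⟨ deg≡count G (σ ⟨$⟩ʳ v) ⟨
  deg G (σ ⟨$⟩ʳ v)            ∎
  where open ≡-Reasoning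

deg-replace : (G : Graph n) {r s k l : Fin n} → k ≢ r → k ≢ s → k ≢ l → G k l ≡ false →
  deg (replace G r s k l) k ≡ suc (deg G k)
deg-replace G {r} {s} {k} {l} k≢r k≢s k≢l kl∉G = begin
  deg (replace G r s k l) k   ≡⟨ deg≡count (replace G r s k l) k ⟩
  count (replace G r s k l k) ≡⟨ count-flip kl∉G (replace-added G (samePair-refl k l)) (λ d d≢l →
                                   sym (replace-kept G (samePair-≢ˡ k≢r k≢s) (samePair-≢₂ k≢l d≢l))) ⟩
  suc (count (G k))           ≡⟨ cong suc (deg≡count G k) ⟨
  suc (deg G k)               ∎
  where open ≡-Reasoning

module _ {G : Graph n} (G-sym : Symmetric G) (G-irr : Irreflexive G) where

  twins⇒deg≡ : ∀ {x y} → Twins G x y → deg G y ≡ deg G x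
  twins⇒deg≡ {x} {y} tw = begin
    deg G y                       ≡⟨ cong (deg G) (transpose-matchˡ x y) ⟨
    deg G (transpose x y ⟨$⟩ʳ x)  ≡⟨ deg-⟪⟫ G (transpose x y) x ⟨
    deg (G ⟪ transpose x y ⟫) x   ≡⟨ deg-≐ (twins⇒Aut G-sym G-irr tw) x ⟩
    deg G x                       ∎
    where open ≡-Reasoning

  shiftedTwins⇒deg≡suc : ∀ {x y c} → ShiftedTwins G x y c → deg G y ≡ suc (deg G x)
  shiftedTwins⇒deg≡suc {x} {y} {c} st = begin
    deg G y                       ≡⟨ cong (deg G) (transpose-matchˡ x y) ⟨
    deg G (transpose x y ⟨$⟩ʳ x)  ≡⟨ deg-⟪⟫ G (transpose x y) x ⟨
    deg (G ⟪ transpose x y ⟫) x   ≡⟨ deg-≐ (shiftedTwins⇒SRep G-sym G-irr st) x ⟩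
    deg (replace G y c x c) x     ≡⟨ deg-replace G x≢y (c≢x ∘ sym) (c≢x ∘ sym) x≁c ⟩
    suc (deg G x)                 ∎
    where
    open ≡-Reasoning
    open ShiftedTwins st

localAmoeba⇒stemTransitive : (G : Graph n) → LocalAmoeba G → ∀ k → StemTransitive G k
localAmoeba⇒stemTransitive G local k = Stab G k , (λ _ s → s) , λ i j i≢k j≢k →
  transpose i j , gen (local _ , transpose-fix (i≢k ∘ sym) (j≢k ∘ sym)) , transpose-matchˡ i j

-- Ladders of shifted twins

module Ladder {G : Graph n} (G-sym : Symmetric G) (G-irr : Irreflexive G)
  (L : ℕ → Fin n → Set) {base : Fin n} (L₀⇒base : ∀ {x} → L 0 x → x ≡ base)
  (descend : ∀ {t x} → L (suc t) x →
    Σ[ x′ ∈ Fin n ] L t x′ × Σ[ c ∈ Fin n ] ShiftedTwins G x′ x c)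
  where

  ladder-deg : ∀ {t x} → L t x → deg G x ≡ t + deg G base
  ladder-deg {zero} Lx = cong (deg G) (L₀⇒base Lx)
  ladder-deg {suc t} Lx with descend Lx
  ... | x′ , Lx′ , _ , st = trans (shiftedTwins⇒deg≡suc G-sym G-irr st) (cong suc (ladder-deg Lx′))

  ladder-swappable : ∀ {t x} → L t x → Swappable (𝓔 G) base x
  ladder-swappable {zero} Lx = subst (Swappable (𝓔 G) base) (sym (L₀⇒base Lx)) swappable-refl
  ladder-swappable {suc t} Lx with descend Lx
  ... | x′ , Lx′ , _ , st =
    swappable-trans (ladder-swappable Lx′) (gen (shiftedTwins⇒𝓔 G-sym G-irr st))

Hℕ : ℕ → ℕ → ℕ → Bool
Hℕ q i j = if i <ᵇ q
  then (if j <ᵇ q then false else (j ∸ q) ≤ᵇ i)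
  else (if j <ᵇ q then (i ∸ q) ≤ᵇ j else not (i ≡ᵇ j))

toℕ-⌊≟⌋ : (a b : Fin n) → ⌊ a ≟ b ⌋ ≡ (toℕ a ≡ᵇ toℕ b)
toℕ-⌊≟⌋ zero zero = refl
toℕ-⌊≟⌋ zero (suc b) = refl
toℕ-⌊≟⌋ (suc a) zero = refl
toℕ-⌊≟⌋ (suc a) (suc b) = trans (⌊⌋-map′ _ _ (a ≟ b)) (toℕ-⌊≟⌋ a b)

H-toℕ : (n : ℕ) (a b : Fin n) → H n a b ≡ Hℕ ⌊ n /2⌋ (toℕ a) (toℕ b)
H-toℕ n a b with toℕ a <ᵇ ⌊ n /2⌋ | toℕ b <ᵇ ⌊ n /2⌋
... | true  | _     = refl
... | false | true  = refl
... | false | false = cong not (toℕ-⌊≟⌋ a b)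

≡ᵇ-comm : ∀ i j → (i ≡ᵇ j) ≡ (j ≡ᵇ i)
≡ᵇ-comm zero zero = refl
≡ᵇ-comm zero (suc j) = refl
≡ᵇ-comm (suc i) zero = refl
≡ᵇ-comm (suc i) (suc j) = ≡ᵇ-comm i j

≤ᵇ-suc : ∀ {k i} → k ≢ suc i → (k ≤ᵇ i) ≡ (k ≤ᵇ suc i)
≤ᵇ-suc {k} {i} k≢1+i with k ≤? i
... | yes k≤i = trans (dec-true (k ≤? i) k≤i) (sym (dec-true (k ≤? suc i) (m≤n⇒m≤1+n k≤i)))
... | no k≰i = trans (dec-false (k ≤? i) k≰i)
                     (sym (dec-false (k ≤? suc i) (λ k≤1+i → k≰i (≤-pred (≤∧≢⇒< k≤1+i k≢1+i)))))

<ᵇ-≤ᵇ : ∀ {j d} → j ≢ d → (suc j ≤ᵇ d) ≡ (j ≤ᵇ d)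
<ᵇ-≤ᵇ {j} {d} j≢d with j ≤? d
... | yes j≤d = trans (dec-true (suc j ≤? d) (≤∧≢⇒< j≤d j≢d)) (sym (dec-true (j ≤? d) j≤d))
... | no j≰d = trans (dec-false (suc j ≤? d) (j≰d ∘ <⇒≤)) (sym (dec-false (j ≤? d) j≰d))

data Side (q : ℕ) : ℕ → Set where
  inA : ∀ {i} → i < q → Side q i
  inB : ∀ j → Side q (q + j)

side : ∀ q i → Side q i
side q i with i <? q
... | yes i<q = inA i<q
... | no i≮q = subst (Side q) (m+[n∸m]≡n (≮⇒≥ i≮q)) (inB (i ∸ q))

module _ {q : ℕ} where

  <ᵇ-q+ : ∀ j → ((q + j) <ᵇ q) ≡ false
  <ᵇ-q+ j = dec-false ((q + j) <? q) (m+n≮m q j)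

  Hℕ-AA : ∀ {i c} → i < q → c < q → Hℕ q i c ≡ false
  Hℕ-AA {i} {c} i<q c<q rewrite dec-true (i <? q) i<q | dec-true (c <? q) c<q = refl

  Hℕ-AB : ∀ {i} k → i < q → Hℕ q i (q + k) ≡ (k ≤ᵇ i)
  Hℕ-AB {i} k i<q rewrite dec-true (i <? q) i<q | <ᵇ-q+ k | m+n∸m≡n q k = refl

  Hℕ-BA : ∀ j {c} → c < q → Hℕ q (q + j) c ≡ (j ≤ᵇ c)
  Hℕ-BA j {c} c<q rewrite <ᵇ-q+ j | dec-true (c <? q) c<q | m+n∸m≡n q j = refl

  Hℕ-BB : ∀ j k → Hℕ q (q + j) (q + k) ≡ not ((q + j) ≡ᵇ (q + k))
  Hℕ-BB j k rewrite <ᵇ-q+ j | <ᵇ-q+ k = refl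

  Hℕ-BB-≢ : ∀ {j k} → j ≢ k → Hℕ q (q + j) (q + k) ≡ true
  Hℕ-BB-≢ {j} {k} j≢k =
    trans (Hℕ-BB j k) (cong not (dec-false ((q + j) ≟ℕ (q + k)) (j≢k ∘ +-cancelˡ-≡ q j k)))

  Hℕ-sym : Symmetric (Hℕ q)
  Hℕ-sym i j with side q i | side q j
  ... | inA i<q | inA j<q = trans (Hℕ-AA i<q j<q) (sym (Hℕ-AA j<q i<q))
  ... | inA i<q | inB k   = trans (Hℕ-AB k i<q) (sym (Hℕ-BA k i<q))
  ... | inB k   | inA j<q = trans (Hℕ-BA k j<q) (sym (Hℕ-AB k j<q))
  ... | inB k   | inB l   =
    trans (Hℕ-BB k l) (trans (cong not (≡ᵇ-comm (q + k) (q + l))) (sym (Hℕ-BB l k)))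

  Hℕ-irrefl : Irreflexive (Hℕ q)
  Hℕ-irrefl i with side q i
  ... | inA i<q = Hℕ-AA i<q i<q
  ... | inB j   = trans (Hℕ-BB j j) (cong not (dec-true ((q + j) ≟ℕ (q + j)) refl))

  Hℕ-shiftedTwins-A : ∀ {i} → suc i < q → ShiftedTwins (Hℕ q) i (suc i) (q + suc i)
  Hℕ-shiftedTwins-A {i} 1+i<q = record
    { x≢y   = <⇒≢ (n<1+n i)
    ; c≢x   = >⇒≢ (<-≤-trans i<q (m≤m+n q (suc i)))
    ; c≢y   = >⇒≢ (<-≤-trans 1+i<q (m≤m+n q (suc i)))
    ; x≁c   = trans (Hℕ-AB (suc i) i<q) (dec-false (suc i ≤? i) (n≮n i))
    ; y∼c   = trans (Hℕ-AB (suc i) 1+i<q) (dec-true (suc i ≤? suc i) ≤-refl)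
    ; twins = λ d _ _ → twins d
    }
    where
    i<q : i < q
    i<q = <-trans (n<1+n i) 1+i<q
    twins : ∀ d → d ≢ q + suc i → Hℕ q i d ≡ Hℕ q (suc i) d
    twins d d≢c with side q d
    ... | inA d<q = trans (Hℕ-AA i<q d<q) (sym (Hℕ-AA 1+i<q d<q))
    ... | inB k   = trans (Hℕ-AB k i<q) (trans (≤ᵇ-suc (d≢c ∘ cong (q +_))) (sym (Hℕ-AB k 1+i<q)))

  Hℕ-shiftedTwins-B : ∀ {j} → j < q → ShiftedTwins (Hℕ q) (q + suc j) (q + j) j
  Hℕ-shiftedTwins-B {j} j<q = record
    { x≢y   = >⇒≢ (+-monoʳ-< q (n<1+n j))
    ; c≢x   = <⇒≢ (<-≤-trans j<q (m≤m+n q (suc j)))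
    ; c≢y   = <⇒≢ (<-≤-trans j<q (m≤m+n q j))
    ; x≁c   = trans (Hℕ-BA (suc j) j<q) (dec-false (suc j ≤? j) (n≮n j))
    ; y∼c   = trans (Hℕ-BA j j<q) (dec-true (j ≤? j) ≤-refl)
    ; twins = twins
    }
    where
    twins : ∀ d → d ≢ q + suc j → d ≢ q + j → d ≢ j → Hℕ q (q + suc j) d ≡ Hℕ q (q + j) d
    twins d d≢x d≢y d≢c with side q d
    ... | inA d<q = trans (Hℕ-BA (suc j) d<q) (trans (<ᵇ-≤ᵇ (d≢c ∘ sym)) (sym (Hℕ-BA j d<q)))
    ... | inB k   = trans (Hℕ-BB-≢ (λ 1+j≡k → d≢x (cong (q +_) (sym 1+j≡k))))
                          (sym (Hℕ-BB-≢ (λ j≡k → d≢y (cong (q +_) (sym j≡k)))))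

  Hℕ-row₀-q : 0 < q → Hℕ q 0 q ≡ true
  Hℕ-row₀-q 0<q = trans (cong (Hℕ q 0) (sym (+-identityʳ q))) (Hℕ-AB 0 0<q)

  Hℕ-row₀ : 0 < q → ∀ d → d ≢ q → Hℕ q 0 d ≡ false
  Hℕ-row₀ 0<q d d≢q with side q d
  ... | inA d<q = Hℕ-AA 0<q d<q
  ... | inB k   = trans (Hℕ-AB k 0<q)
    (dec-false (k ≤? 0) (λ k≤0 → d≢q (trans (cong (q +_) (n≤0⇒n≡0 k≤0)) (+-identityʳ q))))

Hℕ-twins : ∀ {p r} → p ≤ r → r ≤ suc p → ∀ d → d ≤ suc p + r → d ≢ p → d ≢ suc p + r →
  Hℕ (suc p) p d ≡ Hℕ (suc p) (suc p + r) d
Hℕ-twins {p} {r} p≤r r≤q d d≤N d≢p d≢N with side (suc p) d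
... | inA d<q = trans (Hℕ-AA (n<1+n p) d<q) (sym (trans (Hℕ-BA r d<q)
                  (dec-false (r ≤? d) (λ r≤d → n≮n d (<-≤-trans d<p (≤-trans p≤r r≤d))))))
  where
  d<p : d < p
  d<p = ≤∧≢⇒< (≤-pred d<q) d≢p
... | inB k =
  trans (Hℕ-AB k (n<1+n p)) (trans (dec-true (k ≤? p) k≤p) (sym (Hℕ-BB-≢ {q = suc p} (k≢r ∘ sym))))
  where
  k≢r : k ≢ r
  k≢r = d≢N ∘ cong (suc p +_)
  k≤p : k ≤ p
  k≤p = ≤-pred (<-≤-trans (≤∧≢⇒< (+-cancelˡ-≤ (suc p) k r d≤N) k≢r) r≤q)

shiftedTwins-toℕ : {G : Graph n} {h : ℕ → ℕ → Bool} → (∀ a b → G a b ≡ h (toℕ a) (toℕ b)) →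
  ∀ {x y c i j k} → toℕ x ≡ i → toℕ y ≡ j → toℕ c ≡ k → ShiftedTwins h i j k → ShiftedTwins G x y c
shiftedTwins-toℕ {G = G} G≡h {x} {y} refl refl refl st = record
  { x≢y   = x≢y ∘ cong toℕ
  ; c≢x   = c≢x ∘ cong toℕ
  ; c≢y   = c≢y ∘ cong toℕ
  ; x≁c   = trans (G≡h _ _) x≁c
  ; y∼c   = trans (G≡h _ _) y∼c
  ; twins = λ d d≢x d≢y d≢c → trans (G≡h x d) (trans
      (twins (toℕ d) (d≢x ∘ toℕ-injective) (d≢y ∘ toℕ-injective) (d≢c ∘ toℕ-injective))
      (sym (G≡h y d)))
  }
  where open ShiftedTwins st

module Hₙ (m : ℕ) where

  -- With 0-based indices A = [0, q) and B = [q, q + r], where q + r = n − 1. The tops of the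
  -- ladders are P = v_q (index p) and N = v_n (index q + r).
  p q r : ℕ
  p = ⌊ m /2⌋
  q = suc p
  r = ⌈ m /2⌉

  V : Set
  V = Fin (suc (suc m))

  G : Graph (suc (suc m))
  G = H (suc (suc m))

  q+r≡1+m : q + r ≡ suc m
  q+r≡1+m = cong suc (⌊n/2⌋+⌈n/2⌉≡n m)

  p≤r : p ≤ r
  p≤r = ⌊n/2⌋≤⌈n/2⌉ m

  r≤q : r ≤ q
  r≤q = ⌊n/2⌋-mono (n≤1+n (suc m))

  <n : ∀ {i} → i ≤ q + r → i < suc (suc m)
  <n {i} i≤q+r = s≤s (subst (i ≤_) q+r≡1+m i≤q+r)

  G≡Hℕ : ∀ a b → G a b ≡ Hℕ q (toℕ a) (toℕ b)
  G≡Hℕ = H-toℕ (suc (suc m))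

  G-sym : Symmetric G
  G-sym a b = trans (G≡Hℕ a b) (trans (Hℕ-sym {q} (toℕ a) (toℕ b)) (sym (G≡Hℕ b a)))

  G-irrefl : Irreflexive G
  G-irrefl a = trans (G≡Hℕ a a) (Hℕ-irrefl {q} (toℕ a))

  vertex : (i : ℕ) → i ≤ q + r → V
  vertex i i≤q+r = fromℕ< (<n i≤q+r)

  toℕ-vertex : ∀ {i} (i≤q+r : i ≤ q + r) → toℕ (vertex i i≤q+r) ≡ i
  toℕ-vertex i≤q+r = toℕ-fromℕ< (<n i≤q+r)

  toℕ≤q+r : (x : V) → toℕ x ≤ q + r
  toℕ≤q+r x = subst (toℕ x ≤_) (sym q+r≡1+m) (≤-pred (toℕ<n x))

  p≤q+r : p ≤ q + r
  p≤q+r = ≤-trans (n≤1+n p) (m≤m+n q r)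

  P N : V
  P = vertex p p≤q+r
  N = vertex (q + r) ≤-refl

  -- Level t of the two ladders: index t in A, and t steps below the top of B.
  OnA : ℕ → V → Set
  OnA t x = t < q × toℕ x ≡ t

  OnB : ℕ → V → Set
  OnB t x = Σ[ j ∈ ℕ ] j + t ≡ r × toℕ x ≡ q + j

  descendA : ∀ {t x} → OnA (suc t) x →
    Σ[ x′ ∈ V ] OnA t x′ × Σ[ c ∈ V ] ShiftedTwins G x′ x c
  descendA {t} (1+t<q , x≡1+t) =
    vertex t t≤ , (<-trans (n<1+n t) 1+t<q , toℕ-vertex t≤) , vertex (q + suc t) c≤ ,
    shiftedTwins-toℕ G≡Hℕ (toℕ-vertex t≤) x≡1+t (toℕ-vertex c≤) (Hℕ-shiftedTwins-A 1+t<q)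
    where
    t≤ : t ≤ q + r
    t≤ = ≤-trans (≤-trans (n≤1+n t) (≤-pred 1+t<q)) p≤q+r
    c≤ : q + suc t ≤ q + r
    c≤ = +-monoʳ-≤ q (≤-trans (≤-pred 1+t<q) p≤r)

  descendB : ∀ {t x} → OnB (suc t) x →
    Σ[ x′ ∈ V ] OnB t x′ × Σ[ c ∈ V ] ShiftedTwins G x′ x c
  descendB {t} (j , j+1+t≡r , x≡q+j) =
    vertex (q + suc j) x′≤ , (suc j , trans (sym (+-suc j t)) j+1+t≡r , toℕ-vertex x′≤) ,
    vertex j c≤ ,
    shiftedTwins-toℕ G≡Hℕ (toℕ-vertex x′≤) x≡q+j (toℕ-vertex c≤) (Hℕ-shiftedTwins-B (<-≤-trans j<r r≤q))
    where
    j<r : j < r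
    j<r = subst (j <_) j+1+t≡r (m<m+n j z<s)
    x′≤ : q + suc j ≤ q + r
    x′≤ = +-monoʳ-≤ q j<r
    c≤ : j ≤ q + r
    c≤ = ≤-trans (<⇒≤ (<-≤-trans j<r r≤q)) (m≤m+n q r)

  OnA₀⇒zero : ∀ {x} → OnA 0 x → x ≡ zero
  OnA₀⇒zero (_ , x≡0) = toℕ-injective x≡0

  OnB₀⇒N : ∀ {x} → OnB 0 x → x ≡ N
  OnB₀⇒N (j , j+0≡r , x≡q+j) = toℕ-injective (trans x≡q+j
    (trans (cong (q +_) (trans (sym (+-identityʳ j)) j+0≡r)) (sym (toℕ-vertex ≤-refl))))

  module A = Ladder G-sym G-irrefl OnA OnA₀⇒zero descendA
  module B = Ladder G-sym G-irrefl OnB OnB₀⇒N descendB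

  on-ladder : ∀ x → (Σ[ t ∈ ℕ ] OnA t x) ⊎ (Σ[ t ∈ ℕ ] OnB t x)
  on-ladder x with toℕ x <? q
  ... | yes x<q = inj₁ (toℕ x , x<q , refl)
  ... | no x≮q = inj₂ (r ∸ j , j , m+[n∸m]≡n j≤r , sym (m+[n∸m]≡n q≤x))
    where
    q≤x : q ≤ toℕ x
    q≤x = ≮⇒≥ x≮q
    j : ℕ
    j = toℕ x ∸ q
    j≤r : j ≤ r
    j≤r = m≤n+o⇒m∸n≤o (toℕ x) q (toℕ≤q+r x)

  P-onA : OnA p P
  P-onA = n<1+n p , toℕ-vertex p≤q+r

  twins-PN : Twins G P N
  twins-PN d d≢P d≢N = begin
    G P d                   ≡⟨ G≡Hℕ P d ⟩
    Hℕ q (toℕ P) (toℕ d)    ≡⟨ cong (λ i → Hℕ q i (toℕ d)) (toℕ-vertex p≤q+r) ⟩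
    Hℕ q p (toℕ d)          ≡⟨ Hℕ-twins p≤r r≤q (toℕ d) (toℕ≤q+r d)
                                 (≢-toℕ d≢P (toℕ-vertex p≤q+r)) (≢-toℕ d≢N (toℕ-vertex ≤-refl)) ⟩
    Hℕ q (q + r) (toℕ d)    ≡⟨ cong (λ i → Hℕ q i (toℕ d)) (toℕ-vertex ≤-refl) ⟨
    Hℕ q (toℕ N) (toℕ d)    ≡⟨ G≡Hℕ N d ⟨
    G N d                   ∎
    where
    open ≡-Reasoning
    ≢-toℕ : ∀ {x y i} → x ≢ y → toℕ y ≡ i → toℕ x ≢ i
    ≢-toℕ x≢y refl = x≢y ∘ toℕ-injective

  deg-zero : deg G zero ≡ 1
  deg-zero = begin
    deg G zero                        ≡⟨ deg≡count G zero ⟩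
    count (G zero)                    ≡⟨ count-flip {f = λ _ → false} {G zero} {B₀} refl row-B₀ row-other ⟩
    suc (count {suc (suc m)} (λ _ → false)) ≡⟨ cong suc (sum-replicate-zero (suc (suc m))) ⟩
    1                                 ∎
    where
    open ≡-Reasoning
    q≤q+r : q ≤ q + r
    q≤q+r = m≤m+n q r
    B₀ : V
    B₀ = vertex q q≤q+r
    row-B₀ : G zero B₀ ≡ true
    row-B₀ = trans (G≡Hℕ zero B₀) (trans (cong (Hℕ q 0) (toℕ-vertex q≤q+r)) (Hℕ-row₀-q {q} z<s))
    row-other : ∀ d → d ≢ B₀ → false ≡ G zero d
    row-other d d≢B₀ = sym (trans (G≡Hℕ zero d) (Hℕ-row₀ {q} z<s (toℕ d)
      (λ d≡q → d≢B₀ (toℕ-injective (trans d≡q (sym (toℕ-vertex q≤q+r)))))))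

  deg-onA : ∀ {t x} → OnA t x → deg G x ≡ suc t
  deg-onA {t} on = trans (A.ladder-deg on) (trans (cong (t +_) deg-zero) (+-comm t 1))

  deg-N : deg G N ≡ q
  deg-N = trans (twins⇒deg≡ G-sym G-irrefl twins-PN) (deg-onA P-onA)

  deg-onB : ∀ {t x} → OnB t x → deg G x ≡ t + q
  deg-onB {t} on = trans (B.ladder-deg on) (cong (t +_) deg-N)

  deg≥1 : ∀ x → 1 ≤ deg G x
  deg≥1 x with on-ladder x
  ... | inj₁ (t , on) = subst (1 ≤_) (sym (deg-onA on)) (s≤s z≤n)
  ... | inj₂ (t , on) = subst (1 ≤_) (sym (deg-onB on)) (≤-trans (s≤s z≤n) (m≤n+m q t))

  deg≡q⇒P⊎N : ∀ x → deg G x ≡ q → x ≡ P ⊎ x ≡ N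
  deg≡q⇒P⊎N x dx with on-ladder x
  ... | inj₁ (t , t<q , x≡t) =
    inj₁ (toℕ-injective (trans x≡t (trans t≡p (sym (toℕ-vertex p≤q+r)))))
    where
    t≡p : t ≡ p
    t≡p = suc-injective (trans (sym (deg-onA (t<q , x≡t))) dx)
  ... | inj₂ (t , on) = inj₂ (OnB₀⇒N (subst (λ s → OnB s x) t≡0 on))
    where
    t≡0 : t ≡ 0
    t≡0 = +-cancelʳ-≡ q t 0 (trans (sym (deg-onB on)) dx)

  P≢N : P ≢ N
  P≢N P≡N = <⇒≢ (<-≤-trans (n<1+n p) (m≤m+n q r))
    (trans (sym (toℕ-vertex p≤q+r)) (trans (cong toℕ P≡N) (toℕ-vertex ≤-refl)))

  swappable-N : ∀ x → Swappable (𝓔 G) N x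
  swappable-N x with on-ladder x
  ... | inj₂ (_ , on) = B.ladder-swappable on
  ... | inj₁ (_ , on) =
    swappable-trans N~P (swappable-trans (swappable-sym (A.ladder-swappable P-onA)) (A.ladder-swappable on))
    where
    N~P : Swappable (𝓔 G) N P
    N~P = swappable-sym (gen (inj₁ (twins⇒Aut G-sym G-irrefl twins-PN)))

  local : LocalAmoeba G
  local = all-swappable⇒all λ x y → swappable-trans (swappable-sym (swappable-N x)) (swappable-N y)

  rootSimilar : ∀ k → deg G k ≡ q → Σ[ j ∈ V ] RootSimilar G k j
  rootSimilar k dk with deg≡q⇒P⊎N k dk
  ... | inj₁ refl =
    N , P≢N ∘ sym , transpose P N , twins⇒Aut G-sym G-irrefl twins-PN , transpose-matchˡ P N
  ... | inj₂ refl =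
    P , P≢N , transpose N P , twins⇒Aut G-sym G-irrefl (twins-sym {G = G} twins-PN) , transpose-matchˡ N P

proposition3p4 : (n : ℕ) → 2 ≤ n → (k : Fin n) → deg (H n) k ≡ ⌊ n /2⌋ →
    DoubleRootedGlobalAmoeba (H n) k × DoubleRootedLocalAmoeba (H n) k
proposition3p4 (suc (suc m)) (s≤s (s≤s _)) k deg-k = global , global , local
  where
  open Hₙ m
  global : DoubleRootedGlobalAmoeba G k
  global = (deg≥1 , zero , deg-zero) , localAmoeba⇒stemTransitive G local k , rootSimilar k deg-k
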